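{- Let $(S_1,\prec_1,\lhd_1)$ and $(S_2,\prec_2,\lhd_2)$ be Burling sets such that $S_1\cap S_2$ is a non-empty set whose elements are probes in both $(S_1,\prec_1,\lhd_1)$ and $(S_2,\prec_2,\lhd_2)$, and such that there is a set $S_2'\subseteq S_2$ with $S_2'=\{x\in S_2: q\lhd_2 x\}$ for every $q\in S_1\cap S_2$. Then $$\bigl(S_1\cup S_2,\ {\prec_1}\cup{\prec_2}\cup((S_1\setminus S_2)\times S_2'),\ {\lhd_1}\cup{\lhd_2}\bigr)$$ is a Burling set in which every root of $(S_2,\prec_2,\lhd_2)$ that is not in $S_1$ is a root and every probe of $(S_2,\prec_2,\lhd_2)$ is a probe.
   Context: Relations are viewed as sets of ordered pairs. A Burling set is a triple $(S,\prec,\lhd)$ where $S$ is a non-empty finite set, $\prec$ is a strict partial order on $S$, $\lhd$ is an acyclic relation on $S$, and for all $x,y,z\in S$: (A1) if $x\prec y$, $x\prec z$, $y\ne z$, then $y\prec z$ or $z\prec y$; (A2) if $x\lhd y$, $x\lhd z$, $y\neq z$, then $y\prec z$ or $z\prec y$; (A3) if $x\lhd y$ and $x\prec z$, then $y\prec z$; (A4) if $x\lhd y$ and $y\prec z$, then $x\lhd z$ or $x\prec z$. In a Burling set $(S,\prec,\lhd)$: a root is $s\in S$ with no $x\in S$ such that $s\prec x$ or $s\lhd x$; a probe is $p\in S$ with no $x\in S$ such that $p\prec x$, $x\prec p$, or $x\lhd p$. -}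

module Defs where

open import Data.Nat using (ℕ)
open import Data.Fin using (Fin)
open import Data.Fin.Subset using (Subset; _∈_; _∉_; _∪_)
open import Data.Product using (_×_; ∃)
open import Data.Sum using (_⊎_)
open import Relation.Nullary using (¬_)
open import Relation.Binary.PropositionalEquality using (_≡_)
open import Relation.Binary.Structures using (IsStrictPartialOrder)
open import Relation.Binary.Construct.Closure.Transitive using (TransClosure)

-- The ambient universe is Fin n; a finite set S is a Subset n, and a
-- relation on S is a relation on Fin n all of whose pairs lie in S × S.
FRel : ℕ → Set₁
FRel n = Fin n → Fin n → Set

Acyclic : ∀ {n} → FRel n → Set
Acyclic {n} _⊲_ = ∀ (x : Fin n) → ¬ TransClosure _⊲_ x x

record IsBurling {n : ℕ} (S : Subset n) (_≺_ _⊲_ : FRel n) : Set where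
  field
    nonempty : ∃ λ x → x ∈ S
    ≺-on-S   : ∀ {x y} → x ≺ y → x ∈ S × y ∈ S
    ⊲-on-S   : ∀ {x y} → x ⊲ y → x ∈ S × y ∈ S
    ≺-spo    : IsStrictPartialOrder _≡_ _≺_
    ⊲-acyc   : Acyclic _⊲_
    A1 : ∀ {x y z} → x ∈ S → y ∈ S → z ∈ S →
         x ≺ y → x ≺ z → ¬ y ≡ z → y ≺ z ⊎ z ≺ y
    A2 : ∀ {x y z} → x ∈ S → y ∈ S → z ∈ S →
         x ⊲ y → x ⊲ z → ¬ y ≡ z → y ≺ z ⊎ z ≺ y
    A3 : ∀ {x y z} → x ∈ S → y ∈ S → z ∈ S →
         x ⊲ y → x ≺ z → y ≺ z
    A4 : ∀ {x y z} → x ∈ S → y ∈ S → z ∈ S →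
         x ⊲ y → y ≺ z → x ⊲ z ⊎ x ≺ z

IsRoot : ∀ {n} → Subset n → FRel n → FRel n → Fin n → Set
IsRoot {n} S _≺_ _⊲_ s =
  s ∈ S × (∀ (x : Fin n) → x ∈ S → ¬ (s ≺ x) × ¬ (s ⊲ x))

IsProbe : ∀ {n} → Subset n → FRel n → FRel n → Fin n → Set
IsProbe {n} S _≺_ _⊲_ p =
  p ∈ S × (∀ (x : Fin n) → x ∈ S → ¬ (p ≺ x) × ¬ (x ≺ p) × ¬ (x ⊲ p))

_∪ᴿ_ : ∀ {n} → FRel n → FRel n → FRel n
(R ∪ᴿ Q) x y = R x y ⊎ Q x y

DiffProd : ∀ {n} → Subset n → Subset n → Subset n → FRel n
DiffProd A B C x y = (x ∈ A × x ∉ B) × y ∈ C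

-- Every element of S₁ ∩ S₂ is a probe on both sides, so no ≺₁- or ≺₂-edge
-- touches the intersection and every ⊲-edge into it is absent. Hence the two
-- orders and the two arrow relations only meet through the new pairs
-- (S₁ ∖ S₂) × S₂', and every axiom instance mixing the two sides reduces to
-- an axiom of one side applied to a shared probe q: S₂' is exactly the set of
-- ⊲₂-successors of q, so it is a ≺₂-chain (A2) that is upward closed in ≺₂ (A4).
module Submission where

open import Defs
open import Data.Nat using (ℕ)
open import Data.Fin using (Fin)
open import Data.Fin.Subset using (Subset; _∈_; _∉_; _∪_; _⊆_)
open import Data.Fin.Subset.Properties using (_∈?_; p⊆p∪q; q⊆p∪q)
open import Data.Product using (_×_; _,_; ∃; proj₁; proj₂)
open import Data.Sum as Sum using (_⊎_; inj₁; inj₂)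
open import Data.Empty using (⊥-elim)
open import Function.Bundles using (_⇔_; module Equivalence)
open import Relation.Nullary using (¬_; yes; no)
open import Relation.Binary.PropositionalEquality using (_≡_; refl; resp₂)
open import Relation.Binary.PropositionalEquality.Properties using (isEquivalence)
open import Relation.Binary.Structures using (IsStrictPartialOrder)
open import Relation.Binary.Construct.Closure.Transitive using (TransClosure; [_]; _∷_)

module _ {n : ℕ} {R Q : FRel n} where

  ∪⁺-after-left : (∀ {x y z} → R x y → ¬ Q y z) →
    ∀ {x y z} → R x y → TransClosure (R ∪ᴿ Q) y z → TransClosure R x z
  ∪⁺-after-left R⨾Q-empty r [ inj₁ r′ ] = r ∷ [ r′ ]
  ∪⁺-after-left R⨾Q-empty r [ inj₂ q ] = ⊥-elim (R⨾Q-empty r q)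
  ∪⁺-after-left R⨾Q-empty r (inj₁ r′ ∷ p) = r ∷ ∪⁺-after-left R⨾Q-empty r′ p
  ∪⁺-after-left R⨾Q-empty r (inj₂ q ∷ p) = ⊥-elim (R⨾Q-empty r q)

  ∪⁺-after-right : (∀ {x y z} → Q x y → ¬ R y z) →
    ∀ {x y z} → Q x y → TransClosure (R ∪ᴿ Q) y z → TransClosure Q x z
  ∪⁺-after-right Q⨾R-empty q [ inj₂ q′ ] = q ∷ [ q′ ]
  ∪⁺-after-right Q⨾R-empty q [ inj₁ r ] = ⊥-elim (Q⨾R-empty q r)
  ∪⁺-after-right Q⨾R-empty q (inj₂ q′ ∷ p) = q ∷ ∪⁺-after-right Q⨾R-empty q′ p
  ∪⁺-after-right Q⨾R-empty q (inj₁ r ∷ p) = ⊥-elim (Q⨾R-empty q r)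

  Acyclic-∪ : Acyclic R → Acyclic Q →
    (∀ {x y z} → R x y → ¬ Q y z) → (∀ {x y z} → Q x y → ¬ R y z) →
    Acyclic (R ∪ᴿ Q)
  Acyclic-∪ R-acyc Q-acyc R⨾Q-empty Q⨾R-empty x [ inj₁ r ] = R-acyc x [ r ]
  Acyclic-∪ R-acyc Q-acyc R⨾Q-empty Q⨾R-empty x [ inj₂ q ] = Q-acyc x [ q ]
  Acyclic-∪ R-acyc Q-acyc R⨾Q-empty Q⨾R-empty x (inj₁ r ∷ p) =
    R-acyc x (∪⁺-after-left R⨾Q-empty r p)
  Acyclic-∪ R-acyc Q-acyc R⨾Q-empty Q⨾R-empty x (inj₂ q ∷ p) =
    Q-acyc x (∪⁺-after-right Q⨾R-empty q p)

module Burling {n : ℕ} {S : Subset n} {_≺_ _⊲_ : FRel n}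
  (B : IsBurling S _≺_ _⊲_) where

  open IsBurling B public
  open IsStrictPartialOrder ≺-spo public using (irrefl; trans)

  ≺-source : ∀ {x y} → x ≺ y → x ∈ S
  ≺-source r = proj₁ (≺-on-S r)

  ≺-target : ∀ {x y} → x ≺ y → y ∈ S
  ≺-target r = proj₂ (≺-on-S r)

  ⊲-source : ∀ {x y} → x ⊲ y → x ∈ S
  ⊲-source r = proj₁ (⊲-on-S r)

  ⊲-target : ∀ {x y} → x ⊲ y → y ∈ S
  ⊲-target r = proj₂ (⊲-on-S r)

  A1′ : ∀ {x y z} → x ≺ y → x ≺ z → ¬ y ≡ z → y ≺ z ⊎ z ≺ y
  A1′ r s = A1 (≺-source r) (≺-target r) (≺-target s) r s

  A2′ : ∀ {x y z} → x ⊲ y → x ⊲ z → ¬ y ≡ z → y ≺ z ⊎ z ≺ y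
  A2′ r s = A2 (⊲-source r) (⊲-target r) (⊲-target s) r s

  A3′ : ∀ {x y z} → x ⊲ y → x ≺ z → y ≺ z
  A3′ r s = A3 (⊲-source r) (⊲-target r) (≺-target s) r s

  A4′ : ∀ {x y z} → x ⊲ y → y ≺ z → x ⊲ z ⊎ x ≺ z
  A4′ r s = A4 (⊲-source r) (⊲-target r) (≺-target s) r s

  probe-no-≺-out : ∀ {p y} → IsProbe S _≺_ _⊲_ p → ¬ p ≺ y
  probe-no-≺-out (_ , isolated) r = proj₁ (isolated _ (≺-target r)) r

  probe-no-≺-in : ∀ {p x} → IsProbe S _≺_ _⊲_ p → ¬ x ≺ p
  probe-no-≺-in (_ , isolated) r = proj₁ (proj₂ (isolated _ (≺-source r))) r

  probe-no-⊲-in : ∀ {p x} → IsProbe S _≺_ _⊲_ p → ¬ x ⊲ p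
  probe-no-⊲-in (_ , isolated) r = proj₂ (proj₂ (isolated _ (⊲-source r))) r

module Gluing {n : ℕ} (S₁ S₂ S₂' : Subset n) (≺₁ ⊲₁ ≺₂ ⊲₂ : FRel n)
  (burling₁ : IsBurling S₁ ≺₁ ⊲₁) (burling₂ : IsBurling S₂ ≺₂ ⊲₂)
  (shared : ∃ λ q → q ∈ S₁ × q ∈ S₂)
  (shared-probe : ∀ q → q ∈ S₁ → q ∈ S₂ → IsProbe S₁ ≺₁ ⊲₁ q × IsProbe S₂ ≺₂ ⊲₂ q)
  (S₂'⊆S₂ : S₂' ⊆ S₂)
  (S₂'-spec : ∀ q → q ∈ S₁ → q ∈ S₂ → ∀ x → (x ∈ S₂' ⇔ (x ∈ S₂ × ⊲₂ q x)))
  where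

  module B₁ = Burling burling₁
  module B₂ = Burling burling₂

  S : Subset n
  S = S₁ ∪ S₂

  _≺_ : FRel n
  _≺_ = (≺₁ ∪ᴿ ≺₂) ∪ᴿ DiffProd S₁ S₂ S₂'

  _⊲_ : FRel n
  _⊲_ = ⊲₁ ∪ᴿ ⊲₂

  pattern via₁ r = inj₁ (inj₁ r)
  pattern via₂ r = inj₁ (inj₂ r)
  pattern cross x∈S₁ x∉S₂ y∈S₂' = inj₂ ((x∈S₁ , x∉S₂) , y∈S₂')

  S₁⊆S : S₁ ⊆ S
  S₁⊆S = p⊆p∪q S₂

  S₂⊆S : S₂ ⊆ S
  S₂⊆S = q⊆p∪q S₁ S₂

  ≺₁-source∉S₂ : ∀ {x y} → ≺₁ x y → x ∉ S₂
  ≺₁-source∉S₂ r x∈S₂ = B₁.probe-no-≺-out (proj₁ (shared-probe _ (B₁.≺-source r) x∈S₂)) r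

  ≺₁-target∉S₂ : ∀ {x y} → ≺₁ x y → y ∉ S₂
  ≺₁-target∉S₂ r y∈S₂ = B₁.probe-no-≺-in (proj₁ (shared-probe _ (B₁.≺-target r) y∈S₂)) r

  ≺₂-source∉S₁ : ∀ {x y} → ≺₂ x y → x ∉ S₁
  ≺₂-source∉S₁ r x∈S₁ = B₂.probe-no-≺-out (proj₂ (shared-probe _ x∈S₁ (B₂.≺-source r))) r

  ≺₂-target∉S₁ : ∀ {x y} → ≺₂ x y → y ∉ S₁
  ≺₂-target∉S₁ r y∈S₁ = B₂.probe-no-≺-in (proj₂ (shared-probe _ y∈S₁ (B₂.≺-target r))) r

  ⊲₁-target∉S₂ : ∀ {x y} → ⊲₁ x y → y ∉ S₂
  ⊲₁-target∉S₂ r y∈S₂ = B₁.probe-no-⊲-in (proj₁ (shared-probe _ (B₁.⊲-target r) y∈S₂)) r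

  ⊲₂-target∉S₁ : ∀ {x y} → ⊲₂ x y → y ∉ S₁
  ⊲₂-target∉S₁ r y∈S₁ = B₂.probe-no-⊲-in (proj₂ (shared-probe _ y∈S₁ (B₂.⊲-target r))) r

  S₂'⇒⊲₂ : ∀ {q y} → q ∈ S₁ → q ∈ S₂ → y ∈ S₂' → ⊲₂ q y
  S₂'⇒⊲₂ q∈S₁ q∈S₂ y∈S₂' = proj₂ (Equivalence.to (S₂'-spec _ q∈S₁ q∈S₂ _) y∈S₂')

  ⊲₂⇒S₂' : ∀ {q y} → q ∈ S₁ → q ∈ S₂ → ⊲₂ q y → y ∈ S₂'
  ⊲₂⇒S₂' q∈S₁ q∈S₂ r = Equivalence.from (S₂'-spec _ q∈S₁ q∈S₂ _) (B₂.⊲-target r , r)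

  q₀ : Fin n
  q₀ = proj₁ shared

  q₀∈S₁ : q₀ ∈ S₁
  q₀∈S₁ = proj₁ (proj₂ shared)

  q₀∈S₂ : q₀ ∈ S₂
  q₀∈S₂ = proj₂ (proj₂ shared)

  ⊲₂-from-q₀ : ∀ {y} → y ∈ S₂' → ⊲₂ q₀ y
  ⊲₂-from-q₀ = S₂'⇒⊲₂ q₀∈S₁ q₀∈S₂

  S₂'-upward-closed : ∀ {y z} → y ∈ S₂' → ≺₂ y z → z ∈ S₂'
  S₂'-upward-closed y∈S₂' s with B₂.A4′ (⊲₂-from-q₀ y∈S₂') s
  ... | inj₁ q₀⊲₂z = ⊲₂⇒S₂' q₀∈S₁ q₀∈S₂ q₀⊲₂z
  ... | inj₂ q₀≺₂z = ⊥-elim (≺₂-source∉S₁ q₀≺₂z q₀∈S₁)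

  S₂'-chain : ∀ {y z} → y ∈ S₂' → z ∈ S₂' → ¬ y ≡ z → ≺₂ y z ⊎ ≺₂ z y
  S₂'-chain y∈S₂' z∈S₂' = B₂.A2′ (⊲₂-from-q₀ y∈S₂') (⊲₂-from-q₀ z∈S₂')

  probe∉S₂' : ∀ {p} → IsProbe S₂ ≺₂ ⊲₂ p → p ∉ S₂'
  probe∉S₂' p-probe p∈S₂' = B₂.probe-no-⊲-in p-probe (⊲₂-from-q₀ p∈S₂')

  ≺-on-S : ∀ {x y} → x ≺ y → x ∈ S × y ∈ S
  ≺-on-S (via₁ r) = S₁⊆S (B₁.≺-source r) , S₁⊆S (B₁.≺-target r)
  ≺-on-S (via₂ r) = S₂⊆S (B₂.≺-source r) , S₂⊆S (B₂.≺-target r)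
  ≺-on-S (cross x∈S₁ _ y∈S₂') = S₁⊆S x∈S₁ , S₂⊆S (S₂'⊆S₂ y∈S₂')

  ⊲-on-S : ∀ {x y} → x ⊲ y → x ∈ S × y ∈ S
  ⊲-on-S (inj₁ r) = S₁⊆S (B₁.⊲-source r) , S₁⊆S (B₁.⊲-target r)
  ⊲-on-S (inj₂ r) = S₂⊆S (B₂.⊲-source r) , S₂⊆S (B₂.⊲-target r)

  ≺-irrefl : ∀ {x y} → x ≡ y → ¬ x ≺ y
  ≺-irrefl refl (via₁ r) = B₁.irrefl refl r
  ≺-irrefl refl (via₂ r) = B₂.irrefl refl r
  ≺-irrefl refl (cross _ x∉S₂ x∈S₂') = x∉S₂ (S₂'⊆S₂ x∈S₂')

  ≺-trans : ∀ {x y z} → x ≺ y → y ≺ z → x ≺ z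
  ≺-trans (via₁ r) (via₁ s) = via₁ (B₁.trans r s)
  ≺-trans (via₁ r) (via₂ s) = ⊥-elim (≺₁-target∉S₂ r (B₂.≺-source s))
  ≺-trans (via₁ r) (cross _ _ z∈S₂') = cross (B₁.≺-source r) (≺₁-source∉S₂ r) z∈S₂'
  ≺-trans (via₂ r) (via₁ s) = ⊥-elim (≺₂-target∉S₁ r (B₁.≺-source s))
  ≺-trans (via₂ r) (via₂ s) = via₂ (B₂.trans r s)
  ≺-trans (via₂ r) (cross _ y∉S₂ _) = ⊥-elim (y∉S₂ (B₂.≺-target r))
  ≺-trans (cross _ _ y∈S₂') (via₁ s) = ⊥-elim (≺₁-source∉S₂ s (S₂'⊆S₂ y∈S₂'))
  ≺-trans (cross x∈S₁ x∉S₂ y∈S₂') (via₂ s) = cross x∈S₁ x∉S₂ (S₂'-upward-closed y∈S₂' s)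
  ≺-trans (cross _ _ y∈S₂') (cross _ y∉S₂ _) = ⊥-elim (y∉S₂ (S₂'⊆S₂ y∈S₂'))

  ≺-isStrictPartialOrder : IsStrictPartialOrder _≡_ _≺_
  ≺-isStrictPartialOrder = record
    { isEquivalence = isEquivalence
    ; irrefl = ≺-irrefl
    ; trans = ≺-trans
    ; <-resp-≈ = resp₂ _≺_
    }

  ⊲-acyclic : Acyclic _⊲_
  ⊲-acyclic = Acyclic-∪ B₁.⊲-acyc B₂.⊲-acyc
    (λ r s → ⊲₁-target∉S₂ r (B₂.⊲-source s))
    (λ r s → ⊲₂-target∉S₁ r (B₁.⊲-source s))

  A1′ : ∀ {x y z} → x ≺ y → x ≺ z → ¬ y ≡ z → y ≺ z ⊎ z ≺ y
  A1′ (via₁ r) (via₁ s) y≢z = Sum.map via₁ via₁ (B₁.A1′ r s y≢z)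
  A1′ (via₂ r) (via₂ s) y≢z = Sum.map via₂ via₂ (B₂.A1′ r s y≢z)
  A1′ (via₁ r) (via₂ s) _ = ⊥-elim (≺₁-source∉S₂ r (B₂.≺-source s))
  A1′ (via₂ r) (via₁ s) _ = ⊥-elim (≺₁-source∉S₂ s (B₂.≺-source r))
  A1′ (via₁ r) (cross _ _ z∈S₂') _ = inj₁ (cross (B₁.≺-target r) (≺₁-target∉S₂ r) z∈S₂')
  A1′ (cross _ _ y∈S₂') (via₁ s) _ = inj₂ (cross (B₁.≺-target s) (≺₁-target∉S₂ s) y∈S₂')
  A1′ (via₂ r) (cross _ x∉S₂ _) _ = ⊥-elim (x∉S₂ (B₂.≺-source r))
  A1′ (cross _ x∉S₂ _) (via₂ s) _ = ⊥-elim (x∉S₂ (B₂.≺-source s))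
  A1′ (cross _ _ y∈S₂') (cross _ _ z∈S₂') y≢z =
    Sum.map via₂ via₂ (S₂'-chain y∈S₂' z∈S₂' y≢z)

  A2′ : ∀ {x y z} → x ⊲ y → x ⊲ z → ¬ y ≡ z → y ≺ z ⊎ z ≺ y
  A2′ (inj₁ r) (inj₁ s) y≢z = Sum.map via₁ via₁ (B₁.A2′ r s y≢z)
  A2′ (inj₂ r) (inj₂ s) y≢z = Sum.map via₂ via₂ (B₂.A2′ r s y≢z)
  A2′ (inj₁ r) (inj₂ s) _ =
    inj₁ (cross (B₁.⊲-target r) (⊲₁-target∉S₂ r) (⊲₂⇒S₂' (B₁.⊲-source r) (B₂.⊲-source s) s))
  A2′ (inj₂ r) (inj₁ s) _ =
    inj₂ (cross (B₁.⊲-target s) (⊲₁-target∉S₂ s) (⊲₂⇒S₂' (B₁.⊲-source s) (B₂.⊲-source r) r))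

  A3′ : ∀ {x y z} → x ⊲ y → x ≺ z → y ≺ z
  A3′ (inj₁ r) (via₁ s) = via₁ (B₁.A3′ r s)
  A3′ (inj₂ r) (via₂ s) = via₂ (B₂.A3′ r s)
  A3′ (inj₁ r) (via₂ s) = ⊥-elim (≺₂-source∉S₁ s (B₁.⊲-source r))
  A3′ (inj₂ r) (via₁ s) = ⊥-elim (≺₁-source∉S₂ s (B₂.⊲-source r))
  A3′ (inj₁ r) (cross _ _ z∈S₂') = cross (B₁.⊲-target r) (⊲₁-target∉S₂ r) z∈S₂'
  A3′ (inj₂ r) (cross _ x∉S₂ _) = ⊥-elim (x∉S₂ (B₂.⊲-source r))

  A4′ : ∀ {x y z} → x ⊲ y → y ≺ z → x ⊲ z ⊎ x ≺ z
  A4′ (inj₁ r) (via₁ s) = Sum.map inj₁ via₁ (B₁.A4′ r s)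
  A4′ (inj₂ r) (via₂ s) = Sum.map inj₂ via₂ (B₂.A4′ r s)
  A4′ (inj₁ r) (via₂ s) = ⊥-elim (⊲₁-target∉S₂ r (B₂.≺-source s))
  A4′ (inj₂ r) (via₁ s) = ⊥-elim (⊲₂-target∉S₁ r (B₁.≺-source s))
  A4′ {x} (inj₁ r) (cross _ _ z∈S₂') with x ∈? S₂
  ... | yes x∈S₂ = inj₁ (inj₂ (S₂'⇒⊲₂ (B₁.⊲-source r) x∈S₂ z∈S₂'))
  ... | no x∉S₂ = inj₂ (cross (B₁.⊲-source r) x∉S₂ z∈S₂')
  A4′ (inj₂ r) (cross _ y∉S₂ _) = ⊥-elim (y∉S₂ (B₂.⊲-target r))

  isBurling : IsBurling S _≺_ _⊲_
  isBurling = record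
    { nonempty = q₀ , S₁⊆S q₀∈S₁
    ; ≺-on-S = ≺-on-S
    ; ⊲-on-S = ⊲-on-S
    ; ≺-spo = ≺-isStrictPartialOrder
    ; ⊲-acyc = ⊲-acyclic
    ; A1 = λ _ _ _ → A1′
    ; A2 = λ _ _ _ → A2′
    ; A3 = λ _ _ _ → A3′
    ; A4 = λ _ _ _ → A4′
    }

  root-preserved : ∀ {r} → IsRoot S₂ ≺₂ ⊲₂ r → r ∉ S₁ → IsRoot S _≺_ _⊲_ r
  root-preserved {r} (r∈S₂ , maximal) r∉S₁ = S₂⊆S r∈S₂ , λ _ _ → no-≺-out , no-⊲-out
    where
    no-≺-out : ∀ {x} → ¬ r ≺ x
    no-≺-out (via₁ s) = r∉S₁ (B₁.≺-source s)
    no-≺-out (via₂ s) = proj₁ (maximal _ (B₂.≺-target s)) s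
    no-≺-out (cross r∈S₁ _ _) = r∉S₁ r∈S₁

    no-⊲-out : ∀ {x} → ¬ r ⊲ x
    no-⊲-out (inj₁ s) = r∉S₁ (B₁.⊲-source s)
    no-⊲-out (inj₂ s) = proj₂ (maximal _ (B₂.⊲-target s)) s

  probe-preserved : ∀ {p} → IsProbe S₂ ≺₂ ⊲₂ p → IsProbe S _≺_ _⊲_ p
  probe-preserved {p} p-probe@(p∈S₂ , _) =
    S₂⊆S p∈S₂ , λ _ _ → no-≺-out , no-≺-in , no-⊲-in
    where
    no-≺-out : ∀ {x} → ¬ p ≺ x
    no-≺-out (via₁ s) = ≺₁-source∉S₂ s p∈S₂
    no-≺-out (via₂ s) = B₂.probe-no-≺-out p-probe s
    no-≺-out (cross _ p∉S₂ _) = p∉S₂ p∈S₂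

    no-≺-in : ∀ {x} → ¬ x ≺ p
    no-≺-in (via₁ s) = ≺₁-target∉S₂ s p∈S₂
    no-≺-in (via₂ s) = B₂.probe-no-≺-in p-probe s
    no-≺-in (cross _ _ p∈S₂') = probe∉S₂' p-probe p∈S₂'

    no-⊲-in : ∀ {x} → ¬ x ⊲ p
    no-⊲-in (inj₁ s) = ⊲₁-target∉S₂ s p∈S₂
    no-⊲-in (inj₂ s) = B₂.probe-no-⊲-in p-probe s

mainTheorem9 : ∀ {n : ℕ} (S₁ S₂ S₂' : Subset n) (≺₁ ⊲₁ ≺₂ ⊲₂ : FRel n) →
    IsBurling S₁ ≺₁ ⊲₁ → IsBurling S₂ ≺₂ ⊲₂ →
    (∃ λ x → x ∈ S₁ × x ∈ S₂) →
    (∀ q → q ∈ S₁ → q ∈ S₂ → IsProbe S₁ ≺₁ ⊲₁ q × IsProbe S₂ ≺₂ ⊲₂ q) →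
    S₂' ⊆ S₂ →
    (∀ q → q ∈ S₁ → q ∈ S₂ → ∀ x → (x ∈ S₂' ⇔ (x ∈ S₂ × ⊲₂ q x))) →
    IsBurling (S₁ ∪ S₂) ((≺₁ ∪ᴿ ≺₂) ∪ᴿ DiffProd S₁ S₂ S₂') (⊲₁ ∪ᴿ ⊲₂)
    × (∀ r → IsRoot S₂ ≺₂ ⊲₂ r → r ∉ S₁ →
         IsRoot (S₁ ∪ S₂) ((≺₁ ∪ᴿ ≺₂) ∪ᴿ DiffProd S₁ S₂ S₂') (⊲₁ ∪ᴿ ⊲₂) r)
    × (∀ p → IsProbe S₂ ≺₂ ⊲₂ p →
         IsProbe (S₁ ∪ S₂) ((≺₁ ∪ᴿ ≺₂) ∪ᴿ DiffProd S₁ S₂ S₂') (⊲₁ ∪ᴿ ⊲₂) p)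
mainTheorem9 S₁ S₂ S₂' ≺₁ ⊲₁ ≺₂ ⊲₂ burling₁ burling₂ shared shared-probe S₂'⊆S₂ S₂'-spec =
  isBurling , (λ _ → root-preserved) , (λ _ → probe-preserved)
  where
  open Gluing S₁ S₂ S₂' ≺₁ ⊲₁ ≺₂ ⊲₂ burling₁ burling₂ shared shared-probe S₂'⊆S₂ S₂'-spec
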